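{- Let $C: Y^2=\prod_{k=1}^{2g+2}(X-\alpha_k)$ be a hyperelliptic curve over a field of characteristic different from $2$. For pairwise distinct indices: (a) $\mu_{ijrs}=\mu_{rsij}=\mu_{jisr}=\mu_{jirs}^{ -1}=\mu_{ijsr}^{ -1}$; (b) $\ell_{ijr}/\ell_{ijs}=\mu_{ijrs}$; (c) $\ell_{ijk}^{4g}=\prod_{r\neq i,j,k}\mu_{ijkr}^2$.
   Context: For indices $i,j,r,s\in\{1,\dots,2g+2\}$, $\mu_{ijrs}:=\frac{(\alpha_i-\alpha_r)(\alpha_j-\alpha_s)}{(\alpha_i-\alpha_s)(\alpha_j-\alpha_r)}$. For $i\neq j$, $p_{ij}=\zeta\sqrt[2g]{\prod_{k\neq i,j}\frac{\alpha_j-\alpha_k}{\alpha_i-\alpha_k}}$ for a chosen $4g$-th root of unity $\zeta$ and a chosen $2g$-th root, and the symmetric roots are $\ell_{ijk}=p_{ij}\frac{\alpha_i-\alpha_k}{\alpha_j-\alpha_k}$ for $k\neq i,j$, the same choice of $p_{ij}$ being used for all $k$. -}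

module Defs where

open import Level using (Level; _⊔_) renaming (suc to lsuc)
open import Algebra.Bundles using (CommutativeRing)
open import Data.Nat using (ℕ; zero; suc)
open import Data.Fin using (Fin; zero; suc; _≟_)
open import Data.List using (List)
open import Data.List.Relation.Unary.Any using (any?)
open import Data.Bool using (if_then_else_)
open import Relation.Nullary using (¬_; does)
open import Function using (_∘_)

-- The inverse is a total operation whose
-- value at 0 is unspecified (only its behaviour on nonzero elements matters).
record Field (c ℓ : Level) : Set (lsuc (c ⊔ ℓ)) where
  field
    commutativeRing : CommutativeRing c ℓ
  open CommutativeRing commutativeRing public
  field
    _⁻¹        : Carrier → Carrier
    ⁻¹-inverse : ∀ x → ¬ (x ≈ 0#) → (x * (x ⁻¹)) ≈ 1#
    1≉0        : ¬ (1# ≈ 0#)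

module FieldDefs {c ℓ : Level} (F : Field c ℓ) where
  open Field F hiding (zero)

  infixl 7 _/_
  _/_ : Carrier → Carrier → Carrier
  x / y = x * (y ⁻¹)

  pow : Carrier → ℕ → Carrier
  pow x zero    = 1#
  pow x (suc n) = x * pow x n

  ∏ : ∀ {n} → (Fin n → Carrier) → Carrier
  ∏ {zero}  f = 1#
  ∏ {suc n} f = f zero * ∏ (f ∘ suc)

  ∏-except : ∀ {n} → List (Fin n) → (Fin n → Carrier) → Carrier
  ∏-except excl f = ∏ (λ k → if does (any? (k ≟_) excl) then 1# else f k)

  μ : ∀ {n} → (Fin n → Carrier) → Fin n → Fin n → Fin n → Fin n → Carrier
  μ α i j r s = ((α i - α r) * (α j - α s)) / ((α i - α s) * (α j - α r))

  ℓ-root : ∀ {n} → Carrier → (Fin n → Carrier) → Fin n → Fin n → Fin n → Carrier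
  ℓ-root p α i j k = p * ((α i - α k) / (α j - α k))

{-# OPTIONS --safe #-}
module Submission where

-- All identities are identities of rational functions in the α's, valid as
-- soon as every difference α_a − α_b that gets inverted is nonzero.  In (b)
-- the factor p_ij cancels.  For (c), write c = (α_i − α_k)/(α_j − α_k) and
-- f_r = (α_j − α_r)/(α_i − α_r), so that ℓ_ijk = p_ij c and
-- μ_ijkr = f_r c.  This factorisation also holds at r = k, where
-- μ_ijkk = 1, so  ∏_{r ≠ i,j,k} μ_ijkr = ∏_{r ≠ i,j} f_r c = c^{2g} ∏_{r ≠ i,j} f_r.
-- Squaring and using p_ij^{4g} = (∏_{r ≠ i,j} f_r)² gives ℓ_ijk^{4g}.  The same
-- relation shows p_ij ≠ 0, which (b) needs, once three distinct indices force g ≥ 1.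

open import Defs
open import Data.Nat using (ℕ; zero; suc) renaming (_*_ to _*ℕ_; _+_ to _+ℕ_)
open import Data.Nat.Properties using (*-distribʳ-+)
open import Data.Fin using (Fin; zero; suc; _≟_)
open import Data.List using (List; []; _∷_; _∷ʳ_)
open import Data.List.Membership.Propositional using (_∈_; _∉_)
open import Data.List.Membership.Propositional.Properties using (∈-++⁺ˡ; ∈-++⁺ʳ; ∈-++⁻)
open import Data.List.Relation.Unary.Any using (here; there; any?)
open import Data.List.Relation.Unary.All using ([]; _∷_)
open import Data.List.Relation.Unary.All.Properties using (All¬⇒¬Any)
open import Data.List.Relation.Unary.AllPairs using ([]; _∷_)
open import Data.List.Relation.Unary.Unique.Propositional using (Unique)
open import Data.Product using (_×_; _,_)
open import Data.Sum using ([_,_]′)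
open import Data.Bool using (if_then_else_)
open import Function using (_∘_; case_of_)
open import Relation.Nullary using (¬_; does; yes; no; contradiction)
open import Relation.Nullary.Decidable using (dec-true; dec-false)
open import Relation.Binary.PropositionalEquality as ≡ using (_≡_; _≢_; ≢-sym)

import Algebra.Properties.AbelianGroup as AbelianGroupProperties
import Algebra.Properties.CommutativeMonoid.Sum as ProductProperties
import Algebra.Properties.CommutativeSemigroup as CommutativeSemigroupProperties
import Algebra.Properties.CommutativeSemiring.Exp as ExpProperties
import Algebra.Properties.Group as GroupProperties
import Algebra.Properties.Ring as RingProperties

4*g≡2g+2g : ∀ g → 4 *ℕ g ≡ 2 *ℕ g +ℕ 2 *ℕ g
4*g≡2g+2g g = *-distribʳ-+ g 2 2

¬Unique-Fin2 : ∀ {i j k : Fin 2} {xs} → ¬ Unique (i ∷ j ∷ k ∷ xs)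
¬Unique-Fin2 {zero}     {zero}                ((i≢j ∷ _) ∷ _)     = i≢j ≡.refl
¬Unique-Fin2 {zero}     {suc zero} {zero}     ((_ ∷ i≢k ∷ _) ∷ _) = i≢k ≡.refl
¬Unique-Fin2 {zero}     {suc zero} {suc zero} (_ ∷ (j≢k ∷ _) ∷ _) = j≢k ≡.refl
¬Unique-Fin2 {suc zero} {suc zero}            ((i≢j ∷ _) ∷ _)     = i≢j ≡.refl
¬Unique-Fin2 {suc zero} {zero}     {suc zero} ((_ ∷ i≢k ∷ _) ∷ _) = i≢k ≡.refl
¬Unique-Fin2 {suc zero} {zero}     {zero}     (_ ∷ (j≢k ∷ _) ∷ _) = j≢k ≡.refl

∉⇒≢ : ∀ {a} {A : Set a} {x y : A} {xs} → x ∉ y ∷ xs → y ≢ x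
∉⇒≢ x∉y∷xs y≡x = x∉y∷xs (here (≡.sym y≡x))

module FieldProperties {c ℓ} (F : Field c ℓ) where
  open Field F hiding (zero)
  open FieldDefs F
  open import Relation.Binary.Reasoning.Setoid setoid
  open ProductProperties *-commutativeMonoid
    using (sum; sum-cong-≋; sum-replicate; sum-replicate-zero; ∑-distrib-+)
  open CommutativeSemigroupProperties *-commutativeSemigroup using (interchange)
  open ExpProperties commutativeSemiring using (_^_; ^-homo-*; ^-distrib-*)
  open AbelianGroupProperties +-abelianGroup using (⁻¹-anti-homo‿-)
  open GroupProperties +-group using (x∙y⁻¹≈ε⇒x≈y)
  open RingProperties ring using (-‿distribˡ-*; -‿distribʳ-*; -‿involutive)

  private
    variable
      a b x y z : Carrier
      n : ℕ

  *-/-cancelʳ : y ≉ 0# → (x * y) / y ≈ x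
  *-/-cancelʳ {y} {x} y≉0 = begin
    (x * y) * y ⁻¹  ≈⟨ *-assoc x y (y ⁻¹) ⟩
    x * (y * y ⁻¹)  ≈⟨ *-congˡ (⁻¹-inverse y y≉0) ⟩
    x * 1#          ≈⟨ *-identityʳ x ⟩
    x               ∎

  x*y≉0 : x ≉ 0# → y ≉ 0# → x * y ≉ 0#
  x*y≉0 {x} {y} x≉0 y≉0 xy≈0 =
    x≉0 (trans (sym (*-/-cancelʳ y≉0)) (trans (*-congʳ xy≈0) (zeroˡ (y ⁻¹))))

  x⁻¹≉0 : x ≉ 0# → x ⁻¹ ≉ 0#
  x⁻¹≉0 {x} x≉0 x⁻¹≈0 =
    1≉0 (trans (sym (⁻¹-inverse x x≉0)) (trans (*-congˡ x⁻¹≈0) (zeroʳ x)))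

  x-y≉0 : x ≉ y → x - y ≉ 0#
  x-y≉0 {x} {y} x≉y x-y≈0 = x≉y (x∙y⁻¹≈ε⇒x≈y x y x-y≈0)

  *-cancelʳ : z ≉ 0# → x * z ≈ y * z → x ≈ y
  *-cancelʳ {z} {x} {y} z≉0 xz≈yz = begin
    x               ≈⟨ *-/-cancelʳ z≉0 ⟨
    (x * z) * z ⁻¹  ≈⟨ *-congʳ xz≈yz ⟩
    (y * z) * z ⁻¹  ≈⟨ *-/-cancelʳ z≉0 ⟩
    y               ∎

  ⁻¹-unique : x ≉ 0# → x * y ≈ 1# → y ≈ x ⁻¹
  ⁻¹-unique {x} {y} x≉0 xy≈1 =
    *-cancelʳ x≉0 (trans (*-comm y x) (trans xy≈1 (sym (trans (*-comm _ x) (⁻¹-inverse x x≉0)))))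

  ⁻¹-cong : x ≈ y → y ≉ 0# → x ⁻¹ ≈ y ⁻¹
  ⁻¹-cong {x} {y} x≈y y≉0 =
    ⁻¹-unique y≉0 (trans (*-congʳ (sym x≈y)) (⁻¹-inverse x (y≉0 ∘ trans (sym x≈y))))

  ⁻¹-involutive : x ≉ 0# → x ⁻¹ ⁻¹ ≈ x
  ⁻¹-involutive {x} x≉0 =
    sym (⁻¹-unique (x⁻¹≉0 x≉0) (trans (*-comm (x ⁻¹) x) (⁻¹-inverse x x≉0)))

  ⁻¹-distrib-* : x ≉ 0# → y ≉ 0# → (x * y) ⁻¹ ≈ x ⁻¹ * y ⁻¹
  ⁻¹-distrib-* {x} {y} x≉0 y≉0 = sym (⁻¹-unique (x*y≉0 x≉0 y≉0) (begin
    (x * y) * (x ⁻¹ * y ⁻¹)    ≈⟨ interchange x y (x ⁻¹) (y ⁻¹) ⟩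
    (x * x ⁻¹) * (y * y ⁻¹)    ≈⟨ *-cong (⁻¹-inverse x x≉0) (⁻¹-inverse y y≉0) ⟩
    1# * 1#                    ≈⟨ *-identityˡ 1# ⟩
    1#                         ∎))

  [x/y]⁻¹≈y/x : x ≉ 0# → y ≉ 0# → (x / y) ⁻¹ ≈ y / x
  [x/y]⁻¹≈y/x {x} {y} x≉0 y≉0 = begin
    (x * y ⁻¹) ⁻¹      ≈⟨ ⁻¹-distrib-* x≉0 (x⁻¹≉0 y≉0) ⟩
    x ⁻¹ * y ⁻¹ ⁻¹     ≈⟨ *-congˡ (⁻¹-involutive y≉0) ⟩
    x ⁻¹ * y           ≈⟨ *-comm (x ⁻¹) y ⟩
    y * x ⁻¹           ∎

  [a*x]/[b*y]≈[a/b]*[x/y] : b ≉ 0# → y ≉ 0# → (a * x) / (b * y) ≈ (a / b) * (x / y)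
  [a*x]/[b*y]≈[a/b]*[x/y] {b} {y} {a} {x} b≉0 y≉0 = begin
    (a * x) * (b * y) ⁻¹       ≈⟨ *-congˡ (⁻¹-distrib-* b≉0 y≉0) ⟩
    (a * x) * (b ⁻¹ * y ⁻¹)    ≈⟨ interchange a x (b ⁻¹) (y ⁻¹) ⟩
    (a * b ⁻¹) * (x * y ⁻¹)    ∎

  [z*x]/[z*y]≈x/y : z ≉ 0# → y ≉ 0# → (z * x) / (z * y) ≈ x / y
  [z*x]/[z*y]≈x/y {z} {y} {x} z≉0 y≉0 = begin
    (z * x) / (z * y)   ≈⟨ [a*x]/[b*y]≈[a/b]*[x/y] z≉0 y≉0 ⟩
    (z / z) * (x / y)   ≈⟨ *-congʳ (⁻¹-inverse z z≉0) ⟩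
    1# * (x / y)        ≈⟨ *-identityˡ (x / y) ⟩
    x / y               ∎

  [a/b]/[x/y]≈[a*y]/[b*x] : b ≉ 0# → x ≉ 0# → y ≉ 0# → (a / b) / (x / y) ≈ (a * y) / (b * x)
  [a/b]/[x/y]≈[a*y]/[b*x] {b} {x} {y} {a} b≉0 x≉0 y≉0 = begin
    (a / b) * (x / y) ⁻¹  ≈⟨ *-congˡ ([x/y]⁻¹≈y/x x≉0 y≉0) ⟩
    (a / b) * (y / x)     ≈⟨ [a*x]/[b*y]≈[a/b]*[x/y] b≉0 x≉0 ⟨
    (a * y) / (b * x)     ∎

  [b-a]*[y-x]≈[a-b]*[x-y] : ∀ a b x y → (b - a) * (y - x) ≈ (a - b) * (x - y)
  [b-a]*[y-x]≈[a-b]*[x-y] a b x y = begin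
    (b - a) * (y - x)            ≈⟨ *-cong (⁻¹-anti-homo‿- a b) (⁻¹-anti-homo‿- x y) ⟨
    - (a - b) * - (x - y)        ≈⟨ -‿distribˡ-* (a - b) (- (x - y)) ⟨
    - ((a - b) * - (x - y))      ≈⟨ -‿cong (-‿distribʳ-* (a - b) (x - y)) ⟨
    - - ((a - b) * (x - y))      ≈⟨ -‿involutive ((a - b) * (x - y)) ⟩
    (a - b) * (x - y)            ∎

  pow≡^ : ∀ x n → pow x n ≡ x ^ n
  pow≡^ x zero    = ≡.refl
  pow≡^ x (suc n) = ≡.cong (x *_) (pow≡^ x n)

  pow-+ : ∀ x m n → pow x (m +ℕ n) ≈ pow x m * pow x n
  pow-+ x m n rewrite pow≡^ x (m +ℕ n) | pow≡^ x m | pow≡^ x n = ^-homo-* x m n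

  pow-distrib-* : ∀ x y n → pow (x * y) n ≈ pow x n * pow y n
  pow-distrib-* x y n rewrite pow≡^ (x * y) n | pow≡^ x n | pow≡^ y n = ^-distrib-* x y n

  pow-zeroˡ : ∀ n → x ≈ 0# → pow x (suc n) ≈ 0#
  pow-zeroˡ {x} n x≈0 = trans (*-congʳ x≈0) (zeroˡ (pow x n))

  -- Three distinct indices in Fin (e + 2) force e > 0.
  pow-≉0⇒≉0 : ∀ {e} {i j k : Fin (e +ℕ 2)} {xs} → Unique (i ∷ j ∷ k ∷ xs) →
              pow x (e +ℕ e) ≉ 0# → x ≉ 0#
  pow-≉0⇒≉0 {e = zero}  ijk = contradiction ijk ¬Unique-Fin2
  pow-≉0⇒≉0 {e = suc e} _ xⁿ≉0 x≈0 = xⁿ≉0 (pow-zeroˡ (e +ℕ suc e) x≈0)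

  pow-*-root-of-unity : ∀ {ζ q} m → pow ζ (m +ℕ m) ≈ 1# → pow q m ≈ x →
                        pow (ζ * q) (m +ℕ m) ≈ x * x
  pow-*-root-of-unity {x} {ζ} {q} m ζ²ᵐ≈1 qᵐ≈x = begin
    pow (ζ * q) (m +ℕ m)               ≈⟨ pow-distrib-* ζ q (m +ℕ m) ⟩
    pow ζ (m +ℕ m) * pow q (m +ℕ m)    ≈⟨ *-cong ζ²ᵐ≈1 (pow-+ q m m) ⟩
    1# * (pow q m * pow q m)           ≈⟨ *-identityˡ _ ⟩
    pow q m * pow q m                  ≈⟨ *-cong qᵐ≈x qᵐ≈x ⟩
    x * x                              ∎

  ∏≡sum : (f : Fin n → Carrier) → ∏ f ≡ sum f
  ∏≡sum {zero}  f = ≡.refl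
  ∏≡sum {suc n} f = ≡.cong (f zero *_) (∏≡sum (f ∘ suc))

  ∏-cong : {f h : Fin n → Carrier} → (∀ m → f m ≈ h m) → ∏ f ≈ ∏ h
  ∏-cong {f = f} {h} f≈h rewrite ∏≡sum f | ∏≡sum h = sum-cong-≋ f≈h

  ∏-* : (f h : Fin n → Carrier) → ∏ (λ m → f m * h m) ≈ ∏ f * ∏ h
  ∏-* f h rewrite ∏≡sum (λ m → f m * h m) | ∏≡sum f | ∏≡sum h = ∑-distrib-+ f h

  ∏-const : ∀ n x → ∏ {n} (λ _ → x) ≈ pow x n
  ∏-const n x rewrite ∏≡sum {n} (λ _ → x) | pow≡^ x n = sum-replicate n

  ∏-1# : ∀ n → ∏ {n} (λ _ → 1#) ≈ 1#
  ∏-1# n rewrite ∏≡sum {n} (λ _ → 1#) = sum-replicate-zero n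

  ∏-≉0 : (f : Fin n → Carrier) → (∀ m → f m ≉ 0#) → ∏ f ≉ 0#
  ∏-≉0 {zero}  f f≉0 = 1≉0
  ∏-≉0 {suc n} f f≉0 = x*y≉0 (f≉0 zero) (∏-≉0 (f ∘ suc) (f≉0 ∘ suc))

  onlyAt : Fin n → Carrier → Fin n → Carrier
  onlyAt k x m = if does (m ≟ k) then x else 1#

  ∏-onlyAt : ∀ (k : Fin n) x → ∏ (onlyAt k x) ≈ x
  ∏-onlyAt {suc n} zero    x = trans (*-congˡ (∏-1# n)) (*-identityʳ x)
  ∏-onlyAt {suc n} (suc k) x = trans (*-identityˡ _) (∏-onlyAt k x)

  onlyAt-≡ : ∀ {k m : Fin n} x → m ≡ k → onlyAt k x m ≡ x
  onlyAt-≡ {k = k} {m} x m≡k rewrite dec-true (m ≟ k) m≡k = ≡.refl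

  onlyAt-≢ : ∀ {k m : Fin n} x → m ≢ k → onlyAt k x m ≡ 1#
  onlyAt-≢ {k = k} {m} x m≢k rewrite dec-false (m ≟ k) m≢k = ≡.refl

  except : List (Fin n) → (Fin n → Carrier) → Fin n → Carrier
  except L f m = if does (any? (m ≟_) L) then 1# else f m

  except-∈ : ∀ {L} {m : Fin n} f → m ∈ L → except L f m ≡ 1#
  except-∈ {L = L} {m} f m∈L rewrite dec-true (any? (m ≟_) L) m∈L = ≡.refl

  except-∉ : ∀ {L} {m : Fin n} f → m ∉ L → except L f m ≡ f m
  except-∉ {L = L} {m} f m∉L rewrite dec-false (any? (m ≟_) L) m∉L = ≡.refl

  except-cong : ∀ {L} {f h : Fin n → Carrier} → (∀ m → m ∉ L → f m ≈ h m) →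
                ∀ m → except L f m ≈ except L h m
  except-cong {L = L} {f} {h} f≈h m = case any? (m ≟_) L of λ where
    (yes m∈L) → reflexive (≡.trans (except-∈ f m∈L) (≡.sym (except-∈ h m∈L)))
    (no  m∉L) → begin
      except L f m  ≡⟨ except-∉ f m∉L ⟩
      f m           ≈⟨ f≈h m m∉L ⟩
      h m           ≡⟨ except-∉ h m∉L ⟨
      except L h m  ∎

  except-* : ∀ L (f h : Fin n → Carrier) m →
             except L (λ r → f r * h r) m ≈ except L f m * except L h m
  except-* L f h m = case any? (m ≟_) L of λ where
    (yes m∈L) → begin
      except L (λ r → f r * h r) m   ≡⟨ except-∈ (λ r → f r * h r) m∈L ⟩
      1#                             ≈⟨ *-identityˡ 1# ⟨
      1# * 1#                        ≡⟨ ≡.cong₂ _*_ (except-∈ f m∈L) (except-∈ h m∈L) ⟨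
      except L f m * except L h m    ∎
    (no  m∉L) → reflexive (≡.trans (except-∉ (λ r → f r * h r) m∉L)
                                   (≡.sym (≡.cong₂ _*_ (except-∉ f m∉L) (except-∉ h m∉L))))

  except-≉0 : ∀ L (f : Fin n → Carrier) → (∀ m → m ∉ L → f m ≉ 0#) → ∀ m → except L f m ≉ 0#
  except-≉0 L f f≉0 m = case any? (m ≟_) L of λ where
    (yes m∈L) → 1≉0 ∘ trans (reflexive (≡.sym (except-∈ f m∈L)))
    (no  m∉L) → f≉0 m m∉L ∘ trans (reflexive (≡.sym (except-∉ f m∉L)))

  ∉-∷ʳ : ∀ {L} {k m : Fin n} → m ∉ L → m ≢ k → m ∉ L ∷ʳ k
  ∉-∷ʳ {L = L} m∉L m≢k m∈L∷ʳk = [ m∉L , (λ { (here m≡k) → m≢k m≡k }) ]′ (∈-++⁻ L m∈L∷ʳk)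

  except-∷ʳ : ∀ {L} {k : Fin n} f → k ∉ L → ∀ m →
              except L f m ≈ onlyAt k (f k) m * except (L ∷ʳ k) f m
  except-∷ʳ {L = L} {k} f k∉L m = case (any? (m ≟_) L , (m ≟ k)) of λ where
    (yes m∈L , yes m≡k) → contradiction (≡.subst (_∈ L) m≡k m∈L) k∉L
    (yes m∈L , no  m≢k) → begin
      except L f m                                ≡⟨ except-∈ f m∈L ⟩
      1#                                          ≈⟨ *-identityˡ 1# ⟨
      1# * 1#                                     ≡⟨ ≡.cong₂ _*_ (onlyAt-≢ (f k) m≢k) (except-∈ f (∈-++⁺ˡ m∈L)) ⟨
      onlyAt k (f k) m * except (L ∷ʳ k) f m      ∎
    (no  m∉L , yes m≡k) → begin
      except L f m                                ≡⟨ except-∉ f m∉L ⟩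
      f m                                         ≡⟨ ≡.cong f m≡k ⟩
      f k                                         ≈⟨ *-identityʳ (f k) ⟨
      f k * 1#                                    ≡⟨ ≡.cong₂ _*_ (onlyAt-≡ (f k) m≡k) (except-∈ f (∈-++⁺ʳ L (here m≡k))) ⟨
      onlyAt k (f k) m * except (L ∷ʳ k) f m      ∎
    (no  m∉L , no  m≢k) → begin
      except L f m                                ≡⟨ except-∉ f m∉L ⟩
      f m                                         ≈⟨ *-identityˡ (f m) ⟨
      1# * f m                                    ≡⟨ ≡.cong₂ _*_ (onlyAt-≢ (f k) m≢k) (except-∉ f (∉-∷ʳ m∉L m≢k)) ⟨
      onlyAt k (f k) m * except (L ∷ʳ k) f m      ∎

  ∏-except-cong : ∀ L {f h : Fin n → Carrier} → (∀ m → m ∉ L → f m ≈ h m) →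
                  ∏-except L f ≈ ∏-except L h
  ∏-except-cong L f≈h = ∏-cong (except-cong f≈h)

  ∏-except-* : ∀ L (f h : Fin n → Carrier) →
               ∏-except L (λ m → f m * h m) ≈ ∏-except L f * ∏-except L h
  ∏-except-* L f h = trans (∏-cong (except-* L f h)) (∏-* (except L f) (except L h))

  ∏-except-≉0 : ∀ L (f : Fin n → Carrier) → (∀ m → m ∉ L → f m ≉ 0#) → ∏-except L f ≉ 0#
  ∏-except-≉0 L f f≉0 = ∏-≉0 (except L f) (except-≉0 L f f≉0)

  ∏-except-∷ʳ : ∀ L (k : Fin n) f → k ∉ L → ∏-except L f ≈ f k * ∏-except (L ∷ʳ k) f
  ∏-except-∷ʳ L k f k∉L = begin
    ∏-except L f                                       ≈⟨ ∏-cong (except-∷ʳ f k∉L) ⟩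
    ∏ (λ m → onlyAt k (f k) m * except (L ∷ʳ k) f m)   ≈⟨ ∏-* (onlyAt k (f k)) (except (L ∷ʳ k) f) ⟩
    ∏ (onlyAt k (f k)) * ∏-except (L ∷ʳ k) f           ≈⟨ *-congʳ (∏-onlyAt k (f k)) ⟩
    f k * ∏-except (L ∷ʳ k) f                          ∎

  ∏-except-const₂ : ∀ {e} {i j : Fin (e +ℕ 2)} → i ≢ j → x ≉ 0# →
                    ∏-except (i ∷ j ∷ []) (λ _ → x) ≈ pow x e
  ∏-except-const₂ {x} {e} {i} {j} i≢j x≉0 = *-cancelʳ (x*y≉0 x≉0 x≉0) (begin
    K * (x * x)                             ≈⟨ *-comm K (x * x) ⟩
    (x * x) * K                             ≈⟨ *-assoc x x K ⟩
    x * (x * K)                             ≈⟨ *-congˡ (∏-except-∷ʳ (i ∷ []) j (λ _ → x) j∉[i]) ⟨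
    x * ∏-except (i ∷ []) (λ _ → x)         ≈⟨ ∏-except-∷ʳ [] i (λ _ → x) (λ ()) ⟨
    ∏ {e +ℕ 2} (λ _ → x)                    ≈⟨ ∏-const (e +ℕ 2) x ⟩
    pow x (e +ℕ 2)                          ≈⟨ pow-+ x e 2 ⟩
    pow x e * (x * (x * 1#))                ≈⟨ *-congˡ (*-congˡ (*-identityʳ x)) ⟩
    pow x e * (x * x)                       ∎)
    where
    K : Carrier
    K = ∏-except (i ∷ j ∷ []) (λ _ → x)
    j∉[i] : j ∉ i ∷ []
    j∉[i] = All¬⇒¬Any (≢-sym i≢j ∷ [])

  module DistinctRoots {e} (α : Fin (e +ℕ 2) → Carrier) (α-inj : ∀ i j → ¬ (i ≡ j) → ¬ (α i ≈ α j)) where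

    private
      variable
        i j k r s : Fin (e +ℕ 2)
        p : Carrier

    α-α≉0 : i ≢ j → α i - α j ≉ 0#
    α-α≉0 i≢j = x-y≉0 (α-inj _ _ i≢j)

    ratio : Fin (e +ℕ 2) → Fin (e +ℕ 2) → Fin (e +ℕ 2) → Carrier
    ratio i j r = (α j - α r) / (α i - α r)

    ratio≉0 : i ≢ r → j ≢ r → ratio i j r ≉ 0#
    ratio≉0 i≢r j≢r = x*y≉0 (α-α≉0 j≢r) (x⁻¹≉0 (α-α≉0 i≢r))

    ∏-except-ratio≉0 : ∏-except (i ∷ j ∷ []) (ratio i j) ≉ 0#
    ∏-except-ratio≉0 {i} {j} = ∏-except-≉0 (i ∷ j ∷ []) (ratio i j)
      (λ r r∉ij → ratio≉0 (∉⇒≢ r∉ij) (∉⇒≢ (r∉ij ∘ there)))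

    μ-swap-pairs : r ≢ j → s ≢ i → μ α i j r s ≈ μ α r s i j
    μ-swap-pairs {r} {j} {s} {i} r≢j s≢i = *-cong
      ([b-a]*[y-x]≈[a-b]*[x-y] (α r) (α i) (α s) (α j))
      (⁻¹-cong (trans ([b-a]*[y-x]≈[a-b]*[x-y] (α s) (α i) (α r) (α j)) (*-comm _ _))
               (x*y≉0 (α-α≉0 r≢j) (α-α≉0 s≢i)))

    μ-transpose : j ≢ r → i ≢ s → μ α i j r s ≈ μ α j i s r
    μ-transpose j≢r i≢s =
      *-cong (*-comm _ _) (⁻¹-cong (*-comm _ _) (x*y≉0 (α-α≉0 j≢r) (α-α≉0 i≢s)))

    μ-invert : i ≢ r → j ≢ s → i ≢ s → j ≢ r → μ α i j r s ≈ (μ α i j s r) ⁻¹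
    μ-invert i≢r j≢s i≢s j≢r =
      sym ([x/y]⁻¹≈y/x (x*y≉0 (α-α≉0 i≢s) (α-α≉0 j≢r)) (x*y≉0 (α-α≉0 i≢r) (α-α≉0 j≢s)))

    μ-symmetries : Unique (i ∷ j ∷ r ∷ s ∷ []) →
        (μ α i j r s ≈ μ α r s i j)
      × (μ α i j r s ≈ μ α j i s r)
      × (μ α i j r s ≈ (μ α j i r s) ⁻¹)
      × (μ α i j r s ≈ (μ α i j s r) ⁻¹)
    μ-symmetries ((_ ∷ i≢r ∷ i≢s ∷ []) ∷ (j≢r ∷ j≢s ∷ []) ∷ _) =
        μ-swap-pairs (≢-sym j≢r) (≢-sym i≢s)
      , μ-transpose j≢r i≢s
      , trans (μ-transpose j≢r i≢s) (μ-invert j≢s i≢r j≢r i≢s)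
      , μ-invert i≢r j≢s i≢s j≢r

    ℓ-root-ratio : p ≉ 0# → Unique (i ∷ j ∷ r ∷ s ∷ []) →
                   ℓ-root p α i j r / ℓ-root p α i j s ≈ μ α i j r s
    ℓ-root-ratio {p} {i} {j} {r} {s} p≉0 ((_ ∷ _ ∷ i≢s ∷ []) ∷ (j≢r ∷ j≢s ∷ []) ∷ _) = begin
      (p * ratio j i r) / (p * ratio j i s)
        ≈⟨ [z*x]/[z*y]≈x/y p≉0 (ratio≉0 j≢s i≢s) ⟩
      ratio j i r / ratio j i s
        ≈⟨ [a/b]/[x/y]≈[a*y]/[b*x] (α-α≉0 j≢r) (α-α≉0 i≢s) (α-α≉0 j≢s) ⟩
      ((α i - α r) * (α j - α s)) / ((α j - α r) * (α i - α s))
        ≈⟨ *-congˡ (⁻¹-cong (*-comm _ _) (x*y≉0 (α-α≉0 i≢s) (α-α≉0 j≢r))) ⟩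
      μ α i j r s
        ∎

    root≉0 : ∀ {xs} → Unique (i ∷ j ∷ k ∷ xs) →
             pow p (e +ℕ e) ≈ ∏-except (i ∷ j ∷ []) (ratio i j) * ∏-except (i ∷ j ∷ []) (ratio i j) →
             p ≉ 0#
    root≉0 ijk p²ᵉ≈P² = pow-≉0⇒≉0 ijk λ p²ᵉ≈0 →
      x*y≉0 ∏-except-ratio≉0 ∏-except-ratio≉0 (trans (sym p²ᵉ≈P²) p²ᵉ≈0)

    μ≈ratio*ratio : i ≢ r → j ≢ k → μ α i j k r ≈ ratio i j r * ratio j i k
    μ≈ratio*ratio {i} {r} {j} {k} i≢r j≢k =
      trans (*-congʳ (*-comm (α i - α k) (α j - α r)))
            ([a*x]/[b*y]≈[a/b]*[x/y] (α-α≉0 i≢r) (α-α≉0 j≢k))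

    ∏-except-μ : Unique (i ∷ j ∷ k ∷ []) →
      ∏-except (i ∷ j ∷ k ∷ []) (μ α i j k) ≈ ∏-except (i ∷ j ∷ []) (ratio i j) * pow (ratio j i k) e
    ∏-except-μ {i} {j} {k} ((i≢j ∷ i≢k ∷ []) ∷ (j≢k ∷ []) ∷ [] ∷ []) = begin
      ∏-except (i ∷ j ∷ k ∷ []) (μ α i j k)
        ≈⟨ *-identityˡ _ ⟨
      1# * ∏-except (i ∷ j ∷ k ∷ []) (μ α i j k)
        ≈⟨ *-congʳ (⁻¹-inverse _ (x*y≉0 (α-α≉0 i≢k) (α-α≉0 j≢k))) ⟨
      μ α i j k k * ∏-except (i ∷ j ∷ k ∷ []) (μ α i j k)
        ≈⟨ ∏-except-∷ʳ (i ∷ j ∷ []) k (μ α i j k) (All¬⇒¬Any (≢-sym i≢k ∷ ≢-sym j≢k ∷ [])) ⟨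
      ∏-except (i ∷ j ∷ []) (μ α i j k)
        ≈⟨ ∏-except-cong (i ∷ j ∷ []) (λ r r∉ij → μ≈ratio*ratio (∉⇒≢ r∉ij) j≢k) ⟩
      ∏-except (i ∷ j ∷ []) (λ r → ratio i j r * ratio j i k)
        ≈⟨ ∏-except-* (i ∷ j ∷ []) (ratio i j) (λ _ → ratio j i k) ⟩
      ∏-except (i ∷ j ∷ []) (ratio i j) * ∏-except (i ∷ j ∷ []) (λ _ → ratio j i k)
        ≈⟨ *-congˡ (∏-except-const₂ i≢j (ratio≉0 j≢k i≢k)) ⟩
      ∏-except (i ∷ j ∷ []) (ratio i j) * pow (ratio j i k) e
        ∎

    ℓ-root-power : Unique (i ∷ j ∷ k ∷ []) →
      pow p (e +ℕ e) ≈ ∏-except (i ∷ j ∷ []) (ratio i j) * ∏-except (i ∷ j ∷ []) (ratio i j) →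
      pow (ℓ-root p α i j k) (e +ℕ e) ≈ ∏-except (i ∷ j ∷ k ∷ []) (λ r → pow (μ α i j k r) 2)
    ℓ-root-power {i} {j} {k} {p} ijk p²ᵉ≈P² = begin
      pow (p * cₖ) (e +ℕ e)               ≈⟨ pow-distrib-* p cₖ (e +ℕ e) ⟩
      pow p (e +ℕ e) * pow cₖ (e +ℕ e)    ≈⟨ *-cong p²ᵉ≈P² (pow-+ cₖ e e) ⟩
      (P * P) * (pow cₖ e * pow cₖ e)     ≈⟨ interchange P P (pow cₖ e) (pow cₖ e) ⟩
      (P * pow cₖ e) * (P * pow cₖ e)     ≈⟨ *-cong (∏-except-μ ijk) (∏-except-μ ijk) ⟨
      Π * Π                               ≈⟨ ∏-except-* (i ∷ j ∷ k ∷ []) (μ α i j k) (μ α i j k) ⟨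
      ∏-except (i ∷ j ∷ k ∷ []) (λ r → μ α i j k r * μ α i j k r)
        ≈⟨ ∏-except-cong (i ∷ j ∷ k ∷ []) (λ r _ → *-congˡ (*-identityʳ (μ α i j k r))) ⟨
      ∏-except (i ∷ j ∷ k ∷ []) (λ r → pow (μ α i j k r) 2)
        ∎
      where
      cₖ P Π : Carrier
      cₖ = ratio j i k
      P = ∏-except (i ∷ j ∷ []) (ratio i j)
      Π = ∏-except (i ∷ j ∷ k ∷ []) (μ α i j k)

mainTheorem4 : ∀ {c ℓ} (F : Field c ℓ) → let open Field F in let open FieldDefs F in
  ¬ ((1# + 1#) ≈ 0#) →
  (g : ℕ) (α : Fin (2 *ℕ g +ℕ 2) → Carrier) →
  (∀ i j → ¬ (i ≡ j) → ¬ (α i ≈ α j)) →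
  -- (a)
  ((∀ i j r s → Unique (i ∷ j ∷ r ∷ s ∷ []) →
      (μ α i j r s ≈ μ α r s i j)
    × (μ α i j r s ≈ μ α j i s r)
    × (μ α i j r s ≈ (μ α j i r s) ⁻¹)
    × (μ α i j r s ≈ (μ α i j s r) ⁻¹))
  ×
  -- (b) and (c), for any choice p_ij = ζ q with ζ^(4g) = 1 and
  -- q^(2g) = ∏_{k ≠ i,j} (α_j - α_k)/(α_i - α_k)
   (∀ i j → ¬ (i ≡ j) → (ζ q : Carrier) →
      pow ζ (4 *ℕ g) ≈ 1# →
      pow q (2 *ℕ g) ≈ ∏-except (i ∷ j ∷ []) (λ k → (α j - α k) / (α i - α k)) →
        (∀ r s → Unique (i ∷ j ∷ r ∷ s ∷ []) →
           (ℓ-root (ζ * q) α i j r / ℓ-root (ζ * q) α i j s) ≈ μ α i j r s)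
      × (∀ k → Unique (i ∷ j ∷ k ∷ []) →
           pow (ℓ-root (ζ * q) α i j k) (4 *ℕ g)
             ≈ ∏-except (i ∷ j ∷ k ∷ []) (λ r → pow (μ α i j k r) 2))))
mainTheorem4 F _ g α α-inj rewrite 4*g≡2g+2g g =
    (λ _ _ _ _ → μ-symmetries)
  , λ _ _ _ ζ q ζ⁴ᵍ≈1 q²ᵍ≈P →
      let p⁴ᵍ≈P² = pow-*-root-of-unity (2 *ℕ g) ζ⁴ᵍ≈1 q²ᵍ≈P in
        (λ _ _ ijrs → ℓ-root-ratio (root≉0 ijrs p⁴ᵍ≈P²) ijrs)
      , (λ _ ijk → ℓ-root-power ijk p⁴ᵍ≈P²)
  where
  open FieldProperties F
  open DistinctRoots α α-inj
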